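{- Let $f:2^{\mathcal N}\to\mathbb{R}_{\ge0}$ be monotone and submodular, $k\ge1$ an integer, and $O$ an optimal solution of $\max\{f(S):S\subseteq\mathcal N,|S|\le k\}$. Consider the algorithm that initializes $A\gets\emptyset$, then processes the elements $u\in\mathcal N$ one at a time (in any fixed order), adding $u$ to $A$ if and only if $f(A\cup\{u\})-f(A)\ge f(A)/k$ for the current $A$, and finally returns $A'$, the set of the last $k$ elements added to $A$ (or $A'=A$ if fewer than $k$ were added). Then $4f(A')\ge f(O)$.
   Context: $f$ submodular: $f(S\cup\{x\})-f(S)\ge f(T\cup\{x\})-f(T)$ for $S\subseteq T$, $x\notin T$; monotone: $f(S)\le f(T)$ for $S\subseteq T$. -}

module Defs where

open import Level using (Level; _⊔_) renaming (suc to lsuc)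
open import Data.Nat using (ℕ; zero; suc; _∸_; _≤_)
open import Data.Fin using (Fin)
open import Data.Fin.Subset using (Subset; _∪_; ⁅_⁆; _⊆_; ∣_∣; ⊥; _∉_)
open import Data.List using (List; []; _∷_; _++_; foldr; length; drop)
open import Data.List.Membership.Propositional using (_∈_)
open import Data.List.Relation.Unary.Unique.Propositional using (Unique)
open import Data.Product using (Σ; _×_)
open import Algebra.Bundles using (CommutativeRing)
open import Relation.Binary.Structures using (IsTotalOrder)
open import Relation.Nullary using (¬_)

record OrderedField (c ℓ : Level) : Set (lsuc (c ⊔ ℓ)) where
  field
    commutativeRing : CommutativeRing c ℓ
  open CommutativeRing commutativeRing public
  field
    _≤ᶠ_         : Carrier → Carrier → Set ℓ
    isTotalOrder : IsTotalOrder _≈_ _≤ᶠ_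
    +-monoʳ-≤ᶠ   : ∀ {x y} z → x ≤ᶠ y → (x + z) ≤ᶠ (y + z)
    *-nonneg     : ∀ {x y} → 0# ≤ᶠ x → 0# ≤ᶠ y → 0# ≤ᶠ (x * y)
    0≉1          : ¬ (0# ≈ 1#)
    inverse      : ∀ x → ¬ (x ≈ 0#) → Σ Carrier (λ y → (x * y) ≈ 1#)

  infixr 7 _·_
  _·_ : ℕ → Carrier → Carrier
  zero  · x = 0#
  suc m · x = x + (m · x)

module _ {c ℓ : Level} (F : OrderedField c ℓ) where
  open OrderedField F

  module _ {n : ℕ} (f : Subset n → Carrier) where

    NonNegative : Set ℓ
    NonNegative = ∀ S → 0# ≤ᶠ f S

    Monotone : Set ℓ
    Monotone = ∀ S T → S ⊆ T → f S ≤ᶠ f T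

    Submodular : Set ℓ
    Submodular = ∀ S T x → S ⊆ T → x ∉ T →
      (f (T ∪ ⁅ x ⁆) - f T) ≤ᶠ (f (S ∪ ⁅ x ⁆) - f S)

    Optimal : ℕ → Subset n → Set ℓ
    Optimal k O = ∣ O ∣ ≤ k × (∀ S → ∣ S ∣ ≤ k → f S ≤ᶠ f O)

toSet : ∀ {n} → List (Fin n) → Subset n
toSet = foldr (λ x s → ⁅ x ⁆ ∪ s) ⊥

IsOrder : ∀ {n} → List (Fin n) → Set
IsOrder {n} σ = Unique σ × (∀ (x : Fin n) → x ∈ σ)

module Algorithm {c ℓ : Level} (F : OrderedField c ℓ) {n : ℕ}
                 (f : Subset n → OrderedField.Carrier F) (k : ℕ) where
  open OrderedField F

  -- threshold test  f(A ∪ {u}) - f(A) ≥ f(A)/k, written (equivalently, k ≥ 1)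
  -- as  k · (f(A ∪ {u}) - f(A)) ≥ f(A)
  Accept : Subset n → Fin n → Set ℓ
  Accept A u = f A ≤ᶠ (k · (f (A ∪ ⁅ u ⁆) - f A))

  -- Run added σ added' : starting with the list `added` of elements added so far
  -- (in order of addition; A = toSet added), processing the elements σ one at a
  -- time ends with the list `added'`.
  data Run : List (Fin n) → List (Fin n) → List (Fin n) → Set (c ⊔ ℓ) where
    done : ∀ {added} → Run added [] added
    take : ∀ {added u σ out} → Accept (toSet added) u →
           Run (added ++ (u ∷ [])) σ out → Run added (u ∷ σ) out
    skip : ∀ {added u σ out} → ¬ Accept (toSet added) u →
           Run added σ out → Run added (u ∷ σ) out

  lastK : List (Fin n) → List (Fin n)
  lastK xs = drop (length xs ∸ k) xs

-- Write A for the final set and A′ for the set of the last k additions.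
-- Every element outside A was rejected with respect to some earlier subset of A, so by
-- submodularity and monotonicity each x has k (f(A ∪ {x}) − f(A)) ≤ f(A); adding the at most
-- k elements of O one by one gives f(O) ≤ f(A ∪ O) ≤ 2 f(A).  Split the additions as B followed
-- by A′: each element of A′ was accepted with gain at least f(B)/k over a superset of B, so
-- f(A) − f(B) ≥ f(B), while submodularity gives f(A) − f(B) ≤ f(A′) − f(∅) ≤ f(A′).
-- Hence f(A) ≤ 2 f(A′) and f(O) ≤ 4 f(A′).

module Submission where

open import Defs
open import Level using (Level)
open import Data.Nat using (ℕ; zero; suc; _≤_; _∸_; z≤n; s≤s)
open import Data.Nat.Properties using (≤-total; m∸[m∸n]≡n; m≤n⇒m∸n≡0)
open import Data.Fin using (Fin)
open import Data.Fin.Subset using (Subset; _∪_; ⁅_⁆; _⊆_; ∣_∣; ⊥; inside)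
  renaming (_∈_ to _∈ˢ_)
open import Data.Fin.Subset.Properties
  using (∪-assoc; ∪-comm; ∪-identityˡ; ∪-identityʳ; p⊆p∪q; q⊆p∪q; x∈p∪q⁺; x∈p∪q⁻; x∈⁅x⁆; _∈?_; ⊆-min)
open import Data.List as List using (List; []; _∷_; _++_; length; drop; map)
open import Data.List.Properties using (++-assoc; ++-identityʳ; length-map; length-drop; take++drop≡id)
open import Data.List.Membership.Propositional using (_∈_)
open import Data.List.Membership.Propositional.Properties using (∈-map⁺; ∈-++⁺ʳ)
open import Data.List.Relation.Unary.Any using (here; there)
import Data.Vec as Vec
open import Data.Bool using (true; false)
open import Data.Bool.Properties using (∨-identityʳ)
open import Data.Product using (∃-syntax; _×_; _,_)
open import Data.Sum using (inj₁; inj₂)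
open import Relation.Nullary using (¬_; yes; no; contradiction)
open import Relation.Binary.Bundles using (Poset)
open import Relation.Binary.Structures using (IsTotalOrder)
open import Relation.Binary.PropositionalEquality as ≡ using (_≡_; cong; cong₂; subst)

module OrderedFieldProperties {c ℓ : Level} (F : OrderedField c ℓ) where
  open OrderedField F renaming (_≤ᶠ_ to infix 4 _≤ᶠ_)
  open IsTotalOrder isTotalOrder
    using (total) renaming (reflexive to ≤ᶠ-reflexive; trans to ≤ᶠ-trans)
  open import Algebra.Properties.Group +-group using (//-rightDividesˡ; //-rightDividesʳ)
  open import Algebra.Properties.Monoid.Mult +-monoid using (×-congʳ) renaming (_×_ to _×ᴹ_)
  open import Algebra.Properties.CommutativeMonoid.Mult +-commutativeMonoid using (×-distrib-+)

  poset : Poset c ℓ ℓ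
  poset = record { isPartialOrder = IsTotalOrder.isPartialOrder isTotalOrder }

  open import Relation.Binary.Reasoning.PartialOrder poset

  x-y+y≈x : ∀ x y → (x - y) + y ≈ x
  x-y+y≈x x y = //-rightDividesˡ y x

  x+y-y≈x : ∀ x y → (x + y) - y ≈ x
  x+y-y≈x x y = //-rightDividesʳ y x

  [x-y]+[y-z]≈x-z : ∀ x y z → (x - y) + (y - z) ≈ x - z
  [x-y]+[y-z]≈x-z x y z = begin-equality
    (x - y) + (y - z)   ≈⟨ +-assoc x (- y) (y - z) ⟩
    x + (- y + (y - z)) ≈⟨ +-cong refl (+-assoc (- y) y (- z)) ⟨
    x + ((- y + y) - z) ≈⟨ +-cong refl (+-cong (-‿inverseˡ y) refl) ⟩
    x + (0# - z)        ≈⟨ +-cong refl (+-identityˡ (- z)) ⟩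
    x - z               ∎

  +-monoˡ-≤ᶠ : ∀ z {x y} → x ≤ᶠ y → z + x ≤ᶠ z + y
  +-monoˡ-≤ᶠ z {x} {y} x≤y = begin
    z + x ≈⟨ +-comm z x ⟩
    x + z ≤⟨ +-monoʳ-≤ᶠ z x≤y ⟩
    y + z ≈⟨ +-comm y z ⟩
    z + y ∎

  +-mono-≤ᶠ : ∀ {a b x y} → a ≤ᶠ b → x ≤ᶠ y → a + x ≤ᶠ b + y
  +-mono-≤ᶠ {b = b} {x} a≤b x≤y = ≤ᶠ-trans (+-monoʳ-≤ᶠ x a≤b) (+-monoˡ-≤ᶠ b x≤y)

  +-cancelʳ-≤ᶠ : ∀ z {x y} → x + z ≤ᶠ y + z → x ≤ᶠ y
  +-cancelʳ-≤ᶠ z {x} {y} x+z≤y+z = begin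
    x           ≈⟨ x+y-y≈x x z ⟨
    (x + z) - z ≤⟨ +-monoʳ-≤ᶠ (- z) x+z≤y+z ⟩
    (y + z) - z ≈⟨ x+y-y≈x y z ⟩
    y           ∎

  x≤x+y : ∀ {x y} → 0# ≤ᶠ y → x ≤ᶠ x + y
  x≤x+y {x} {y} 0≤y = begin
    x      ≈⟨ +-identityʳ x ⟨
    x + 0# ≤⟨ +-monoˡ-≤ᶠ x 0≤y ⟩
    x + y  ∎

  x-y≤x : ∀ {x y} → 0# ≤ᶠ y → x - y ≤ᶠ x
  x-y≤x {x} {y} 0≤y = +-cancelʳ-≤ᶠ y (begin
    (x - y) + y ≈⟨ x-y+y≈x x y ⟩
    x           ≤⟨ x≤x+y 0≤y ⟩
    x + y       ∎)

  x≤y⇒0≤y-x : ∀ {x y} → x ≤ᶠ y → 0# ≤ᶠ y - x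
  x≤y⇒0≤y-x {x} {y} x≤y = begin
    0#    ≈⟨ -‿inverseʳ x ⟨
    x - x ≤⟨ +-monoʳ-≤ᶠ (- x) x≤y ⟩
    y - x ∎

  ≰ᶠ⇒≥ᶠ : ∀ {x y} → ¬ (x ≤ᶠ y) → y ≤ᶠ x
  ≰ᶠ⇒≥ᶠ {x} {y} x≰y with total x y
  ... | inj₁ x≤y = contradiction x≤y x≰y
  ... | inj₂ y≤x = y≤x

  ·≡× : ∀ m x → m · x ≡ m ×ᴹ x
  ·≡× zero    x = ≡.refl
  ·≡× (suc m) x = cong (x +_) (·≡× m x)

  ·-congʳ : ∀ m {x y} → x ≈ y → m · x ≈ m · y
  ·-congʳ m {x} {y} rewrite ·≡× m x | ·≡× m y = ×-congʳ m

  ·-distribˡ-+ : ∀ m x y → m · (x + y) ≈ m · x + m · y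
  ·-distribˡ-+ m x y rewrite ·≡× m (x + y) | ·≡× m x | ·≡× m y = ×-distrib-+ x y m

  ·-zeroʳ : ∀ m → m · 0# ≈ 0#
  ·-zeroʳ zero    = refl
  ·-zeroʳ (suc m) = trans (+-identityˡ (m · 0#)) (·-zeroʳ m)

  ·-monoʳ-≤ᶠ : ∀ m {x y} → x ≤ᶠ y → m · x ≤ᶠ m · y
  ·-monoʳ-≤ᶠ zero    x≤y = ≤ᶠ-reflexive refl
  ·-monoʳ-≤ᶠ (suc m) x≤y = +-mono-≤ᶠ x≤y (·-monoʳ-≤ᶠ m x≤y)

  ·-nonneg : ∀ m {x} → 0# ≤ᶠ x → 0# ≤ᶠ m · x
  ·-nonneg m {x} 0≤x = begin
    0#     ≈⟨ ·-zeroʳ m ⟨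
    m · 0# ≤⟨ ·-monoʳ-≤ᶠ m 0≤x ⟩
    m · x  ∎

  ·-monoˡ-≤ᶠ : ∀ {m n} x → 0# ≤ᶠ x → m ≤ n → m · x ≤ᶠ n · x
  ·-monoˡ-≤ᶠ {n = n} x 0≤x z≤n       = ·-nonneg n 0≤x
  ·-monoˡ-≤ᶠ         x 0≤x (s≤s m≤n) = +-monoˡ-≤ᶠ x (·-monoˡ-≤ᶠ x 0≤x m≤n)

  ·-cancelˡ-≤ᶠ : ∀ m {x y} → 1 ≤ m → m · x ≤ᶠ m · y → x ≤ᶠ y
  ·-cancelˡ-≤ᶠ (suc m) {x} {y} _ mx≤my with total x y
  ... | inj₁ x≤y = x≤y
  ... | inj₂ y≤x = begin
    x           ≈⟨ x-y+y≈x x y ⟨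
    (x - y) + y ≤⟨ +-monoʳ-≤ᶠ y x-y≤0 ⟩
    0# + y      ≈⟨ +-identityˡ y ⟩
    y           ∎
    where
    x-y≤0 : x - y ≤ᶠ 0#
    x-y≤0 = +-cancelʳ-≤ᶠ (suc m · y) (begin
      (x - y) + suc m · y         ≤⟨ +-monoʳ-≤ᶠ _ (x≤x+y (·-nonneg m (x≤y⇒0≤y-x y≤x))) ⟩
      suc m · (x - y) + suc m · y ≈⟨ ·-distribˡ-+ (suc m) (x - y) y ⟨
      suc m · ((x - y) + y)       ≈⟨ ·-congʳ (suc m) (x-y+y≈x x y) ⟩
      suc m · x                   ≤⟨ mx≤my ⟩
      suc m · y                   ≈⟨ +-identityˡ _ ⟨
      0# + suc m · y              ∎)

  [x+x]+[x+x]≈4·x : ∀ x → (x + x) + (x + x) ≈ 4 · x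
  [x+x]+[x+x]≈4·x x = begin-equality
    (x + x) + (x + x) ≈⟨ +-assoc x x (x + x) ⟩
    x + (x + (x + x)) ≈⟨ +-cong refl (+-cong refl (+-cong refl (+-identityʳ x))) ⟨
    4 · x             ∎

∪-monoˡ-⊆ : ∀ {n} {p q : Subset n} r → p ⊆ q → p ∪ r ⊆ q ∪ r
∪-monoˡ-⊆ {p = p} r p⊆q x∈p∪r with x∈p∪q⁻ p r x∈p∪r
... | inj₁ x∈p = x∈p∪q⁺ (inj₁ (p⊆q x∈p))
... | inj₂ x∈r = x∈p∪q⁺ (inj₂ x∈r)

x∈p⇒p∪⁅x⁆≡p : ∀ {n} {x : Fin n} (p : Subset n) → x ∈ˢ p → p ∪ ⁅ x ⁆ ≡ p
x∈p⇒p∪⁅x⁆≡p (.inside Vec.∷ p) Vec.here          = cong (inside Vec.∷_) (∪-identityʳ p)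
x∈p⇒p∪⁅x⁆≡p (b Vec.∷ p)       (Vec.there x∈p) = cong₂ Vec._∷_ (∨-identityʳ b) (x∈p⇒p∪⁅x⁆≡p p x∈p)

toSet-++ : ∀ {n} (xs ys : List (Fin n)) → toSet (xs ++ ys) ≡ toSet xs ∪ toSet ys
toSet-++ []       ys = ≡.sym (∪-identityˡ (toSet ys))
toSet-++ (x ∷ xs) ys =
  ≡.trans (cong (⁅ x ⁆ ∪_) (toSet-++ xs ys)) (≡.sym (∪-assoc ⁅ x ⁆ (toSet xs) (toSet ys)))

toSet-∷ʳ : ∀ {n} (xs : List (Fin n)) x → toSet (xs ++ x ∷ []) ≡ toSet xs ∪ ⁅ x ⁆
toSet-∷ʳ xs x = ≡.trans (toSet-++ xs (x ∷ [])) (cong (toSet xs ∪_) (∪-identityʳ ⁅ x ⁆))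

∈⇒∈toSet : ∀ {n} {x : Fin n} {xs} → x ∈ xs → x ∈ˢ toSet xs
∈⇒∈toSet {x = x} (here ≡.refl) = x∈p∪q⁺ (inj₁ (x∈⁅x⁆ x))
∈⇒∈toSet         (there x∈xs)  = x∈p∪q⁺ (inj₂ (∈⇒∈toSet x∈xs))

elements : ∀ {n} → Subset n → List (Fin n)
elements Vec.[]          = []
elements (true  Vec.∷ p) = Fin.zero ∷ map Fin.suc (elements p)
elements (false Vec.∷ p) = map Fin.suc (elements p)

length-elements : ∀ {n} (p : Subset n) → length (elements p) ≡ ∣ p ∣
length-elements Vec.[]          = ≡.refl
length-elements (true  Vec.∷ p) = cong suc (≡.trans (length-map Fin.suc (elements p)) (length-elements p))
length-elements (false Vec.∷ p) = ≡.trans (length-map Fin.suc (elements p)) (length-elements p)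

∈⇒∈elements : ∀ {n} {x : Fin n} (p : Subset n) → x ∈ˢ p → x ∈ elements p
∈⇒∈elements (.inside Vec.∷ p) Vec.here       = here ≡.refl
∈⇒∈elements (true  Vec.∷ p)   (Vec.there x∈p) = there (∈-map⁺ Fin.suc (∈⇒∈elements p x∈p))
∈⇒∈elements (false Vec.∷ p)   (Vec.there x∈p) = ∈-map⁺ Fin.suc (∈⇒∈elements p x∈p)

module SetFunctionProperties {c ℓ : Level} (F : OrderedField c ℓ) {n : ℕ}
                             (f : Subset n → OrderedField.Carrier F) where
  open OrderedField F renaming (_≤ᶠ_ to infix 4 _≤ᶠ_)
  open OrderedFieldProperties F
  open import Relation.Binary.Reasoning.PartialOrder poset

  gain : Subset n → Subset n → Carrier
  gain A B = f (A ∪ B) - f A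

  gain-⊥ : ∀ A → gain A ⊥ ≈ 0#
  gain-⊥ A = begin-equality
    f (A ∪ ⊥) - f A ≡⟨ cong (λ B → f B - f A) (∪-identityʳ A) ⟩
    f A - f A       ≈⟨ -‿inverseʳ (f A) ⟩
    0#              ∎

  gain-∈ : ∀ {x} A → x ∈ˢ A → gain A ⁅ x ⁆ ≈ 0#
  gain-∈ {x} A x∈A = begin-equality
    f (A ∪ ⁅ x ⁆) - f A ≡⟨ cong (λ B → f B - f A) (x∈p⇒p∪⁅x⁆≡p A x∈A) ⟩
    f A - f A           ≈⟨ -‿inverseʳ (f A) ⟩
    0#                  ∎

  gain-∪ : ∀ A B C → gain A (B ∪ C) ≈ gain A B + gain (A ∪ B) C
  gain-∪ A B C = begin-equality
    f (A ∪ (B ∪ C)) - f A     ≡⟨ cong (λ D → f D - f A) (∪-assoc A B C) ⟨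
    f ((A ∪ B) ∪ C) - f A     ≈⟨ [x-y]+[y-z]≈x-z _ (f (A ∪ B)) _ ⟨
    gain (A ∪ B) C + gain A B ≈⟨ +-comm _ _ ⟩
    gain A B + gain (A ∪ B) C ∎

  module _ (mono : Monotone F f) where

    gain-nonneg : ∀ A B → 0# ≤ᶠ gain A B
    gain-nonneg A B = x≤y⇒0≤y-x (mono A (A ∪ B) (p⊆p∪q B))

    module _ (submod : Submodular F f) where

      gain-antitone : ∀ {S T} x → S ⊆ T → gain T ⁅ x ⁆ ≤ᶠ gain S ⁅ x ⁆
      gain-antitone {S} {T} x S⊆T with x ∈? T
      ... | no  x∉T = submod S T x S⊆T x∉T
      ... | yes x∈T = begin
        gain T ⁅ x ⁆ ≈⟨ gain-∈ T x∈T ⟩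
        0#           ≤⟨ gain-nonneg S ⁅ x ⁆ ⟩
        gain S ⁅ x ⁆ ∎

      gain-antitone-toSet : ∀ {S T} xs → S ⊆ T → gain T (toSet xs) ≤ᶠ gain S (toSet xs)
      gain-antitone-toSet {S} {T} [] S⊆T = begin
        gain T ⊥ ≈⟨ gain-⊥ T ⟩
        0#       ≈⟨ gain-⊥ S ⟨
        gain S ⊥ ∎
      gain-antitone-toSet {S} {T} (x ∷ xs) S⊆T = begin
        gain T (⁅ x ⁆ ∪ X)                ≈⟨ gain-∪ T ⁅ x ⁆ X ⟩
        gain T ⁅ x ⁆ + gain (T ∪ ⁅ x ⁆) X ≤⟨ +-mono-≤ᶠ (gain-antitone x S⊆T)
                                               (gain-antitone-toSet xs (∪-monoˡ-⊆ ⁅ x ⁆ S⊆T)) ⟩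
        gain S ⁅ x ⁆ + gain (S ∪ ⁅ x ⁆) X ≈⟨ gain-∪ S ⁅ x ⁆ X ⟨
        gain S (⁅ x ⁆ ∪ X)                ∎
        where
        X : Subset n
        X = toSet xs

module ThresholdAlgorithm {c ℓ : Level} (F : OrderedField c ℓ) {n : ℕ}
                          (f : Subset n → OrderedField.Carrier F) (k : ℕ) where
  open OrderedField F renaming (_≤ᶠ_ to infix 4 _≤ᶠ_)
  open OrderedFieldProperties F
  open SetFunctionProperties F f
  open Algorithm F f k
  open import Relation.Binary.Reasoning.PartialOrder poset

  data Accepted : Subset n → List (Fin n) → Set ℓ where
    []  : ∀ {A} → Accepted A []
    _∷_ : ∀ {A u us} → Accept A u → Accepted (A ∪ ⁅ u ⁆) us → Accepted A (u ∷ us)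

  Saturated : Subset n → Set ℓ
  Saturated A = ∀ x → k · gain A ⁅ x ⁆ ≤ᶠ f A

  accepted-++ : ∀ {A} xs {ys} → Accepted A (xs ++ ys) → Accepted (A ∪ toSet xs) ys
  accepted-++ {A} []       acc       = subst (λ B → Accepted B _) (≡.sym (∪-identityʳ A)) acc
  accepted-++ {A} (x ∷ xs) (_ ∷ acc) =
    subst (λ B → Accepted B _) (∪-assoc A ⁅ x ⁆ (toSet xs)) (accepted-++ xs acc)

  run⇒accepted : ∀ {xs σ ys} → Run xs σ ys → ∃[ zs ] ys ≡ xs ++ zs × Accepted (toSet xs) zs
  run⇒accepted {xs} done = [] , ≡.sym (++-identityʳ xs) , []
  run⇒accepted {xs} (take {u = u} accept r) with run⇒accepted r
  ... | zs , ys≡ , acc = u ∷ zs , ≡.trans ys≡ (++-assoc xs (u ∷ []) zs)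
                       , accept ∷ subst (λ B → Accepted B zs) (toSet-∷ʳ xs u) acc
  run⇒accepted (skip _ r) = run⇒accepted r

  run-accepted : ∀ {σ ys} → Run [] σ ys → Accepted ⊥ ys
  run-accepted r with run⇒accepted r
  ... | _ , ≡.refl , acc = acc

  run-⊆ : ∀ {xs σ ys} → Run xs σ ys → toSet xs ⊆ toSet ys
  run-⊆ {xs} r with run⇒accepted r
  ... | zs , ≡.refl , _ = λ x∈xs → subst (_ ∈ˢ_) (≡.sym (toSet-++ xs zs)) (p⊆p∪q (toSet zs) x∈xs)

  module Properties (nonneg : NonNegative F f) (mono : Monotone F f) (submod : Submodular F f) where

    run-saturated : ∀ {xs σ ys} → Run xs σ ys →
                    ∀ x → x ∈ σ → k · gain (toSet ys) ⁅ x ⁆ ≤ᶠ f (toSet ys)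
    run-saturated (take {xs} {u} {out = ys} _ r) x (here ≡.refl) = begin
      k · gain (toSet ys) ⁅ u ⁆ ≈⟨ ·-congʳ k (gain-∈ (toSet ys) (run-⊆ r u∈xs++u)) ⟩
      k · 0#                    ≈⟨ ·-zeroʳ k ⟩
      0#                        ≤⟨ nonneg (toSet ys) ⟩
      f (toSet ys)              ∎
      where
      u∈xs++u : u ∈ˢ toSet (xs ++ u ∷ [])
      u∈xs++u = ∈⇒∈toSet (∈-++⁺ʳ xs (here ≡.refl))
    run-saturated (skip {xs} {u} {out = ys} rejected r) x (here ≡.refl) = begin
      k · gain (toSet ys) ⁅ u ⁆ ≤⟨ ·-monoʳ-≤ᶠ k (gain-antitone mono submod u (run-⊆ r)) ⟩
      k · gain (toSet xs) ⁅ u ⁆ ≤⟨ ≰ᶠ⇒≥ᶠ rejected ⟩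
      f (toSet xs)              ≤⟨ mono (toSet xs) (toSet ys) (run-⊆ r) ⟩
      f (toSet ys)              ∎
    run-saturated (take _ r) x (there x∈σ) = run-saturated r x x∈σ
    run-saturated (skip _ r) x (there x∈σ) = run-saturated r x x∈σ

    saturated-gain : ∀ {A} → Saturated A → ∀ xs → k · gain A (toSet xs) ≤ᶠ length xs · f A
    saturated-gain {A} _ [] = begin
      k · gain A ⊥ ≈⟨ ·-congʳ k (gain-⊥ A) ⟩
      k · 0#       ≈⟨ ·-zeroʳ k ⟩
      0#           ∎
    saturated-gain {A} sat (x ∷ xs) = begin
      k · gain A (⁅ x ⁆ ∪ X)                ≡⟨ cong (λ B → k · gain A B) (∪-comm ⁅ x ⁆ X) ⟩
      k · gain A (X ∪ ⁅ x ⁆)                ≈⟨ ·-congʳ k (gain-∪ A X ⁅ x ⁆) ⟩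
      k · (gain A X + gain (A ∪ X) ⁅ x ⁆)   ≈⟨ ·-distribˡ-+ k _ _ ⟩
      k · gain A X + k · gain (A ∪ X) ⁅ x ⁆ ≤⟨ +-mono-≤ᶠ (saturated-gain sat xs)
                                                 (·-monoʳ-≤ᶠ k (gain-antitone mono submod x (p⊆p∪q X))) ⟩
      length xs · f A + k · gain A ⁅ x ⁆    ≤⟨ +-monoˡ-≤ᶠ _ (sat x) ⟩
      length xs · f A + f A                 ≈⟨ +-comm _ _ ⟩
      length (x ∷ xs) · f A                 ∎
      where
      X : Subset n
      X = toSet xs

    saturated-bound : 1 ≤ k → ∀ {A} → Saturated A → ∀ O → ∣ O ∣ ≤ k → f O ≤ᶠ f A + f A
    saturated-bound 1≤k {A} sat O ∣O∣≤k = ·-cancelˡ-≤ᶠ k 1≤k (begin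
      k · f O                             ≤⟨ ·-monoʳ-≤ᶠ k (mono O (A ∪ L) O⊆A∪L) ⟩
      k · f (A ∪ L)                       ≈⟨ ·-congʳ k (x-y+y≈x (f (A ∪ L)) (f A)) ⟨
      k · (gain A L + f A)                ≈⟨ ·-distribˡ-+ k _ _ ⟩
      k · gain A L + k · f A              ≤⟨ +-monoʳ-≤ᶠ _ (saturated-gain sat (elements O)) ⟩
      length (elements O) · f A + k · f A ≤⟨ +-monoʳ-≤ᶠ _ (·-monoˡ-≤ᶠ (f A) (nonneg A) ∣elements∣≤k) ⟩
      k · f A + k · f A                   ≈⟨ ·-distribˡ-+ k _ _ ⟨
      k · (f A + f A)                     ∎)
      where
      L : Subset n
      L = toSet (elements O)
      O⊆A∪L : O ⊆ A ∪ L
      O⊆A∪L x∈O = q⊆p∪q A L (∈⇒∈toSet (∈⇒∈elements O x∈O))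
      ∣elements∣≤k : length (elements O) ≤ k
      ∣elements∣≤k = subst (_≤ k) (≡.sym (length-elements O)) ∣O∣≤k

    accepted-gain : ∀ {A xs} → Accepted A xs → length xs · f A ≤ᶠ k · gain A (toSet xs)
    accepted-gain {A} [] = ·-nonneg k (gain-nonneg mono A ⊥)
    accepted-gain {A} {u ∷ us} (accept ∷ acc) = begin
      f A + length us · f A                         ≤⟨ +-monoˡ-≤ᶠ _ (·-monoʳ-≤ᶠ (length us) fA≤fA∪u) ⟩
      f A + length us · f (A ∪ ⁅ u ⁆)               ≤⟨ +-monoʳ-≤ᶠ _ accept ⟩
      k · gain A ⁅ u ⁆ + length us · f (A ∪ ⁅ u ⁆)  ≤⟨ +-monoˡ-≤ᶠ _ (accepted-gain acc) ⟩
      k · gain A ⁅ u ⁆ + k · gain (A ∪ ⁅ u ⁆) U     ≈⟨ ·-distribˡ-+ k _ _ ⟨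
      k · (gain A ⁅ u ⁆ + gain (A ∪ ⁅ u ⁆) U)       ≈⟨ ·-congʳ k (gain-∪ A ⁅ u ⁆ U) ⟨
      k · gain A (⁅ u ⁆ ∪ U)                        ∎
      where
      U : Subset n
      U = toSet us
      fA≤fA∪u : f A ≤ᶠ f (A ∪ ⁅ u ⁆)
      fA≤fA∪u = mono A (A ∪ ⁅ u ⁆) (p⊆p∪q ⁅ u ⁆)

    accepted-bound : 1 ≤ k → ∀ {A xs} → Accepted A xs → length xs ≡ k →
                     f (A ∪ toSet xs) ≤ᶠ f (toSet xs) + f (toSet xs)
    accepted-bound 1≤k {A} {xs} acc ∣xs∣≡k = begin
      f (A ∪ X)           ≈⟨ x-y+y≈x (f (A ∪ X)) (f A) ⟨
      gain A X + f A      ≤⟨ +-monoˡ-≤ᶠ (gain A X) fA≤gain ⟩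
      gain A X + gain A X ≤⟨ +-mono-≤ᶠ gain≤fX gain≤fX ⟩
      f X + f X           ∎
      where
      X : Subset n
      X = toSet xs
      fA≤gain : f A ≤ᶠ gain A X
      fA≤gain = ·-cancelˡ-≤ᶠ k 1≤k (subst (λ m → m · f A ≤ᶠ k · gain A X) ∣xs∣≡k (accepted-gain acc))
      gain≤fX : gain A X ≤ᶠ f X
      gain≤fX = begin
        gain A X        ≤⟨ gain-antitone-toSet mono submod xs (⊆-min A) ⟩
        f (⊥ ∪ X) - f ⊥ ≤⟨ x-y≤x (nonneg ⊥) ⟩
        f (⊥ ∪ X)       ≡⟨ cong f (∪-identityˡ X) ⟩
        f X             ∎

    accepted-lastK-bound : 1 ≤ k → ∀ {xs} → Accepted ⊥ xs →
                           f (toSet xs) ≤ᶠ f (toSet (lastK xs)) + f (toSet (lastK xs))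
    accepted-lastK-bound 1≤k {xs} acc with ≤-total k (length xs)
    ... | inj₂ ∣xs∣≤k rewrite m≤n⇒m∸n≡0 ∣xs∣≤k = x≤x+y (nonneg (toSet xs))
    ... | inj₁ k≤∣xs∣ = begin
      f (toSet xs)              ≡⟨ cong (λ ys → f (toSet ys)) (take++drop≡id m xs) ⟨
      f (toSet (B ++ C))        ≡⟨ cong f (toSet-++ B C) ⟩
      f (toSet B ∪ toSet C)     ≤⟨ accepted-bound 1≤k accC ∣C∣≡k ⟩
      f (toSet C) + f (toSet C) ∎
      where
      m : ℕ
      m = length xs ∸ k
      B C : List (Fin n)
      B = List.take m xs
      C = drop m xs
      accC : Accepted (toSet B) C
      accC = subst (λ A → Accepted A C) (∪-identityˡ (toSet B))
               (accepted-++ B (subst (Accepted ⊥) (≡.sym (take++drop≡id m xs)) acc))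
      ∣C∣≡k : length C ≡ k
      ∣C∣≡k = ≡.trans (length-drop m xs) (m∸[m∸n]≡n k≤∣xs∣)

theorem4 : ∀ {c ℓ : Level} (F : OrderedField c ℓ) {n : ℕ}
               (f : Subset n → OrderedField.Carrier F) (k : ℕ) →
               NonNegative F f → Monotone F f → Submodular F f → 1 ≤ k →
               (O : Subset n) → Optimal F f k O →
               (σ : List (Fin n)) → IsOrder σ →
               (added : List (Fin n)) → Algorithm.Run F f k [] σ added →
               OrderedField._≤ᶠ_ F (f O)
                 (OrderedField._·_ F 4 (f (toSet (Algorithm.lastK F f k added))))
theorem4 F {n} f k nonneg mono submod 1≤k O (∣O∣≤k , _) σ (_ , σ-complete) added run = begin
  f O                           ≤⟨ saturated-bound 1≤k saturated O ∣O∣≤k ⟩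
  f A + f A                     ≤⟨ +-mono-≤ᶠ fA≤2fA′ fA≤2fA′ ⟩
  (f A′ + f A′) + (f A′ + f A′) ≈⟨ [x+x]+[x+x]≈4·x (f A′) ⟩
  4 · f A′                      ∎
  where
  open OrderedField F renaming (_≤ᶠ_ to infix 4 _≤ᶠ_)
  open OrderedFieldProperties F
  open Algorithm F f k using (lastK)
  open ThresholdAlgorithm F f k
  open Properties nonneg mono submod
  open import Relation.Binary.Reasoning.PartialOrder poset
  A A′ : Subset n
  A  = toSet added
  A′ = toSet (lastK added)
  saturated : Saturated A
  saturated x = run-saturated run x (σ-complete x)
  fA≤2fA′ : f A ≤ᶠ f A′ + f A′
  fA≤2fA′ = accepted-lastK-bound 1≤k (run-accepted run)
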